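{- Let $n\ge 4$. Then $\Theta_1(\Lambda_n)\cup\Theta_n(\Lambda_n)$ is a maximal (with respect to inclusion) edge general position set of $\Lambda_n$. Moreover, ${\rm gp_e}(\Lambda_n)\ge 2F_{n-1}$.
   Context: Fibonacci numbers: $F_0=0$, $F_1=1$, $F_{m+2}=F_{m+1}+F_m$. The Lucas cube $\Lambda_n$ is the graph whose vertices are the binary strings of length $n$ with no two consecutive 1s and not both starting and ending with 1, two vertices being adjacent iff they differ in exactly one coordinate. For $i\in\{1,\ldots,n\}$, $\Theta_i(\Lambda_n)$ is the set of edges of $\Lambda_n$ whose endpoints differ in coordinate $i$. A set of edges $X\subseteq E(G)$ is an edge general position set of a graph $G$ if no three edges of $X$ lie on a common shortest path of $G$; ${\rm gp_e}(G)$ is the maximum cardinality of an edge general position set of $G$. -}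

module Defs where

open import Data.Nat using (ℕ; zero; suc; _+_; _*_; _∸_; _≤_)
open import Data.Bool using (Bool; true; false)
open import Data.Fin using (Fin; toℕ)
open import Data.Vec using (Vec; lookup)
open import Data.List using (List; length)
open import Data.List.Membership.Propositional using (_∈_)
open import Data.List.Relation.Unary.All using (All)
open import Data.List.Relation.Unary.AllPairs using (AllPairs)
open import Data.Product using (Σ; _×_; _,_)
open import Data.Sum using (_⊎_)
open import Data.Empty using (⊥)
open import Relation.Nullary using (¬_)
open import Relation.Binary.PropositionalEquality using (_≡_; _≢_)

fib : ℕ → ℕ
fib zero = 0
fib (suc zero) = 1
fib (suc (suc m)) = fib (suc m) + fib m

-- Binary strings of length n; coordinate k (1-based, as in the paper)
-- is the entry at index k-1 (of type Fin n).
BStr : ℕ → Set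
BStr n = Vec Bool n

IsLucas : (n : ℕ) → BStr n → Set
IsLucas n x =
  (∀ (i j : Fin n) → toℕ j ≡ suc (toℕ i) →
      ¬ (lookup x i ≡ true × lookup x j ≡ true))
  × (∀ (i j : Fin n) → toℕ i ≡ 0 → toℕ j ≡ n ∸ 1 →
      ¬ (lookup x i ≡ true × lookup x j ≡ true))

DifferInOne : (n : ℕ) → BStr n → BStr n → Set
DifferInOne n u v = Σ (Fin n) λ i →
  (lookup u i ≢ lookup v i) × (∀ (j : Fin n) → j ≢ i → lookup u j ≡ lookup v j)

IsEdge : (n : ℕ) → BStr n → BStr n → Set
IsEdge n u v = IsLucas n u × IsLucas n v × DifferInOne n u v

-- An edge set is a predicate X on ordered pairs; the (unordered) edge
-- {u , v} belongs to the set iff X u v holds (all sets used below are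
-- symmetric).
EdgeSet : ℕ → Set₁
EdgeSet n = BStr n → BStr n → Set

SameEdge : {n : ℕ} → BStr n → BStr n → BStr n → BStr n → Set
SameEdge a b c d = (a ≡ c × b ≡ d) ⊎ (a ≡ d × b ≡ c)

data Walk (n : ℕ) : BStr n → BStr n → ℕ → Set where
  here : ∀ {u} → IsLucas n u → Walk n u u 0
  step : ∀ {u w v k} → IsLucas n u → DifferInOne n u w →
         Walk n w v k → Walk n u v (suc k)

EdgeOn : ∀ {n u v k} → Walk n u v k → BStr n → BStr n → Set
EdgeOn (here _) a b = ⊥
EdgeOn (step {u = u} {w = w} _ _ p) a b = SameEdge a b u w ⊎ EdgeOn p a b

IsShortest : ∀ {n u v k} → Walk n u v k → Set
IsShortest {n} {u} {v} {k} _ = ∀ (k′ : ℕ) → Walk n u v k′ → k ≤ k′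

OnCommonGeodesic : (n : ℕ) → (a₁ b₁ a₂ b₂ a₃ b₃ : BStr n) → Set
OnCommonGeodesic n a₁ b₁ a₂ b₂ a₃ b₃ =
  Σ (BStr n) λ u → Σ (BStr n) λ v → Σ ℕ λ k → Σ (Walk n u v k) λ p →
    IsShortest p × EdgeOn p a₁ b₁ × EdgeOn p a₂ b₂ × EdgeOn p a₃ b₃

IsEdgeGP : (n : ℕ) → EdgeSet n → Set
IsEdgeGP n X =
  (∀ u v → X u v → IsEdge n u v)
  × (∀ a₁ b₁ a₂ b₂ a₃ b₃ → X a₁ b₁ → X a₂ b₂ → X a₃ b₃ →
       ¬ SameEdge a₁ b₁ a₂ b₂ → ¬ SameEdge a₁ b₁ a₃ b₃ → ¬ SameEdge a₂ b₂ a₃ b₃ →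
       ¬ OnCommonGeodesic n a₁ b₁ a₂ b₂ a₃ b₃)

addEdge : {n : ℕ} → EdgeSet n → BStr n → BStr n → EdgeSet n
addEdge X u v a b = X a b ⊎ SameEdge a b u v

IsMaximalEdgeGP : (n : ℕ) → EdgeSet n → Set
IsMaximalEdgeGP n X =
  IsEdgeGP n X
  × (∀ u v → IsEdge n u v → ¬ X u v → ¬ IsEdgeGP n (addEdge X u v))

Theta1n : (n : ℕ) → EdgeSet n
Theta1n n u v = IsEdge n u v × Σ (Fin n) λ i →
  (toℕ i ≡ 0 ⊎ toℕ i ≡ n ∸ 1) × lookup u i ≢ lookup v i

listSet : {n : ℕ} → List (BStr n × BStr n) → EdgeSet n
listSet L a b = ((a , b) ∈ L) ⊎ ((b , a) ∈ L)

GpeAtLeast : (n : ℕ) → ℕ → Set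
GpeAtLeast n k = Σ (List (BStr n × BStr n)) λ L →
  AllPairs (λ e f → ¬ SameEdge (Data.Product.proj₁ e) (Data.Product.proj₂ e)
                              (Data.Product.proj₁ f) (Data.Product.proj₂ f)) L
  × IsEdgeGP n (listSet L)
  × k ≤ length L

module Submission where

-- The Lucas cube is isometric in the hypercube: from u one can always reach v by a
-- path that only flips coordinates in which the current string still disagrees
-- with v (first clear the surplus 1s, which stays inside Λ_n, then set the missing
-- ones, which stays below v).  Hence a path is shortest iff every step moves towards
-- its end, and such a path flips each coordinate at most once; by pigeonhole no
-- shortest path carries three edges of Θ₁ ∪ Θₙ.  For maximality, an edge xy of Θᵢ
-- with 1 < i < n lies on a shortest path from x with coordinate 1 pinned to 1 (its
-- neighbours set to 0) to y with coordinate n pinned to 1; its endpoints differ in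
-- coordinates 1 and n, so the path also crosses Θ₁ and Θₙ.  Raising coordinate 1 in
-- 0 0 w 0 and coordinate n in 0 w 0 0, for the F_{n-1} Fibonacci strings w of
-- length n-3, gives 2 F_{n-1} distinct edges of Θ₁ ∪ Θₙ.

open import Defs
open import Data.Bool using (Bool; true; false)
open import Data.Bool.Properties using (¬-not) renaming (_≟_ to _≟ᵇ_)
open import Data.Empty using (⊥; ⊥-elim)
open import Data.Fin using (Fin; zero; suc; toℕ; fromℕ; inject₁)
open import Data.Fin.Properties using (toℕ-injective; toℕ-fromℕ; toℕ-inject₁; toℕ<n; any?; fromℕ≢inject₁)
  renaming (_≟_ to _≟ᶠ_; suc-injective to suc-injectiveᶠ)
open import Data.List using (List; []; _∷_; _++_; map; length)
open import Data.List.Properties using (length-++; length-map)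
open import Data.List.Membership.Propositional using (_∈_)
open import Data.List.Membership.Propositional.Properties using (∈-map⁻)
open import Data.List.Relation.Unary.All using (All)
import Data.List.Relation.Unary.All as All
import Data.List.Relation.Unary.All.Properties as All
open import Data.List.Relation.Unary.AllPairs using (AllPairs)
import Data.List.Relation.Unary.AllPairs as AllPairs
import Data.List.Relation.Unary.AllPairs.Properties as AllPairs
open import Data.List.Relation.Unary.Unique.Propositional using (Unique)
import Data.List.Relation.Unary.Unique.Propositional.Properties as Unique
open import Data.Nat using (ℕ; zero; suc; _+_; _*_; _∸_; _≤_; s≤s; s≤s⁻¹)
open import Data.Nat.Properties
  using (≤-reflexive; ≤-trans; n≤1+n; n<1+n; <-irrefl; 1+n≢n; 0≢1+n; +-suc; +-identityʳ; suc-injective;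
         module ≤-Reasoning)
open import Data.Product using (Σ; _×_; _,_; proj₁; proj₂; map₂)
open import Data.Sum using (_⊎_; inj₁; inj₂)
import Data.Sum as Sum
open import Data.Unit using (⊤; tt)
open import Data.Vec using (Vec; []; _∷_; lookup; _[_]≔_; _∷ʳ_)
open import Data.Vec.Properties
  using (lookup∘update; lookup∘update′; []≔-lookup; tabulate∘lookup; tabulate-cong;
         ∷-injectiveʳ; ∷ʳ-injectiveˡ)
open import Function using (_∘_; id)
open import Relation.Nullary using (¬_; Dec; yes; no)
open import Relation.Nullary.Decidable using (_×-dec_; ¬?; decidable-stable)
open import Relation.Binary.PropositionalEquality

private
  variable
    k n : ℕ
    a b c d u v w x y z t : BStr n
    i j j′ : Fin n

≢-true-false : {e f : Bool} → e ≡ true → f ≡ false → e ≢ f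
≢-true-false refl refl ()

≢-≢⇒≡ : {a b c : Bool} → a ≢ b → a ≢ c → b ≡ c
≢-≢⇒≡ a≢b a≢c = trans (¬-not (a≢b ∘ sym)) (sym (¬-not (a≢c ∘ sym)))

≢⇒between : {a c : Bool} (b : Bool) → a ≢ c → a ≡ b ⊎ b ≡ c
≢⇒between {a} b a≢c with a ≟ᵇ b
... | yes a≡b = inj₁ a≡b
... | no a≢b = inj₂ (≢-≢⇒≡ a≢b a≢c)

lookup-extensionality : {A : Set} (u v : Vec A n) → (∀ i → lookup u i ≡ lookup v i) → u ≡ v
lookup-extensionality u v eq =
  trans (sym (tabulate∘lookup u)) (trans (tabulate-cong eq) (tabulate∘lookup v))

lookup-∷ʳ-last : {A : Set} (v : Vec A k) {e : A} → lookup (v ∷ʳ e) (fromℕ k) ≡ e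
lookup-∷ʳ-last []      = refl
lookup-∷ʳ-last (_ ∷ v) = lookup-∷ʳ-last v

lookup-∷ʳ-inject₁ : {A : Set} (v : Vec A k) {e : A} (i : Fin k) → lookup (v ∷ʳ e) (inject₁ i) ≡ lookup v i
lookup-∷ʳ-inject₁ (_ ∷ v) zero    = refl
lookup-∷ʳ-inject₁ (_ ∷ v) (suc i) = lookup-∷ʳ-inject₁ v i

DiffersAt : BStr n → BStr n → Fin n → Set
DiffersAt a b c = lookup a c ≢ lookup b c

-- DifferInOne n u w unfolds to Σ (Fin n) (DifferOnlyAt u w).
DifferOnlyAt : BStr n → BStr n → Fin n → Set
DifferOnlyAt u w i = DiffersAt u w i × (∀ j → j ≢ i → lookup u j ≡ lookup w j)

differOnlyAt-sym : DifferOnlyAt u w i → DifferOnlyAt w u i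
differOnlyAt-sym (ne , eq) = ne ∘ sym , λ j j≢i → sym (eq j j≢i)

differOnlyAt-unique : DifferOnlyAt u w i → DiffersAt u w j → j ≡ i
differOnlyAt-unique {i = i} {j = j} (_ , eq) dj with j ≟ᶠ i
... | yes j≡i = j≡i
... | no j≢i = ⊥-elim (dj (eq j j≢i))

isEdge-differsAt-unique : IsEdge n a b → DiffersAt a b i → DiffersAt a b j → i ≡ j
isEdge-differsAt-unique {a = a} {b} (_ , _ , _ , flip) dᵢ dⱼ =
  trans (differOnlyAt-unique {u = a} {w = b} flip dᵢ) (sym (differOnlyAt-unique {u = a} {w = b} flip dⱼ))

differOnlyAt-[]≔ : (u : BStr n) (i : Fin n) {e : Bool} → lookup u i ≢ e → DifferOnlyAt u (u [ i ]≔ e) i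
differOnlyAt-[]≔ u i {e} ne =
  (λ eq → ne (trans eq (lookup∘update i u e))) , λ j j≢i → sym (lookup∘update′ j≢i u e)

isEdge-sym : IsEdge n a b → IsEdge n b a
isEdge-sym {a = a} {b} (la , lb , i , d) = lb , la , i , differOnlyAt-sym {u = a} {w = b} d

sameEdge-sym : SameEdge a b c d → SameEdge c d a b
sameEdge-sym (inj₁ (refl , refl)) = inj₁ (refl , refl)
sameEdge-sym (inj₂ (refl , refl)) = inj₂ (refl , refl)

sameEdge-trans : SameEdge a b c d → SameEdge c d u w → SameEdge a b u w
sameEdge-trans (inj₁ (refl , refl)) s = s
sameEdge-trans (inj₂ (refl , refl)) (inj₁ (refl , refl)) = inj₂ (refl , refl)
sameEdge-trans (inj₂ (refl , refl)) (inj₂ (refl , refl)) = inj₁ (refl , refl)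

sameEdge-differsAt : SameEdge a b c d → DiffersAt a b j → DiffersAt c d j
sameEdge-differsAt (inj₁ (refl , refl)) dab = dab
sameEdge-differsAt (inj₂ (refl , refl)) dab = dab ∘ sym

mismatch : Bool → Bool → ℕ
mismatch false false = 0
mismatch false true  = 1
mismatch true  false = 1
mismatch true  true  = 0

mismatch-self : ∀ e → mismatch e e ≡ 0
mismatch-self false = refl
mismatch-self true  = refl

mismatch-≢ : {e f : Bool} → e ≢ f → mismatch e f ≡ 1
mismatch-≢ {false} {false} ne = ⊥-elim (ne refl)
mismatch-≢ {false} {true}  _  = refl
mismatch-≢ {true}  {false} _  = refl
mismatch-≢ {true}  {true}  ne = ⊥-elim (ne refl)

hamming : BStr n → BStr n → ℕ
hamming []      []      = 0
hamming (e ∷ u) (f ∷ v) = mismatch e f + hamming u v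

hamming-self : (u : BStr n) → hamming u u ≡ 0
hamming-self []      = refl
hamming-self (e ∷ u) rewrite mismatch-self e = hamming-self u

hamming-step : (u w v : BStr n) (i : Fin n) → DifferOnlyAt u w i → DiffersAt u v i →
               hamming u v ≡ suc (hamming w v)
hamming-step (e ∷ u) (f ∷ w) (g ∷ v) zero (e≢f , eq) e≢g
  rewrite lookup-extensionality u w (λ j → eq (suc j) λ ())
        | ≢-≢⇒≡ e≢f e≢g | mismatch-≢ e≢g | mismatch-self g = refl
hamming-step (e ∷ u) (f ∷ w) (g ∷ v) (suc i) (ne , eq) nv rewrite eq zero λ () =
  trans (cong (mismatch f g +_) (hamming-step u w v i (ne , λ j j≢i → eq (suc j) (j≢i ∘ suc-injectiveᶠ)) nv))
        (+-suc (mismatch f g) (hamming w v))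

-- Shortest paths of the Lucas cube

walk-source-lucas : ∀ {u v : BStr n} {k} → Walk n u v k → IsLucas n u
walk-source-lucas (here lu)     = lu
walk-source-lucas (step lu _ _) = lu

walk-target-lucas : ∀ {u v : BStr n} {k} → Walk n u v k → IsLucas n v
walk-target-lucas (here lv)    = lv
walk-target-lucas (step _ _ p) = walk-target-lucas p

hamming≤length : ∀ {k} → Walk n u v k → hamming u v ≤ k
hamming≤length {u = u} (here _) = ≤-reflexive (hamming-self u)
hamming≤length {u = u} {v} (step {w = w} {k = k} _ (i , flip) p) with lookup u i ≟ᵇ lookup v i
... | no uᵢ≢vᵢ = ≤-trans (≤-reflexive (hamming-step u w v i flip uᵢ≢vᵢ)) (s≤s (hamming≤length p))
... | yes uᵢ≡vᵢ = begin
  hamming u v       ≤⟨ n≤1+n _ ⟩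
  suc (hamming u v) ≡⟨ hamming-step w u v i (differOnlyAt-sym {u = u} {w = w} flip) wᵢ≢vᵢ ⟨
  hamming w v       ≤⟨ hamming≤length p ⟩
  k                 ≤⟨ n≤1+n _ ⟩
  suc k             ∎
  where
  open ≤-Reasoning
  wᵢ≢vᵢ : DiffersAt w v i
  wᵢ≢vᵢ wᵢ≡vᵢ = proj₁ flip (trans uᵢ≡vᵢ (sym wᵢ≡vᵢ))

Towards : ∀ {u v : BStr n} {k} → BStr n → Walk n u v k → Set
Towards t (here _)                       = ⊤
Towards t (step {u = u} _ (i , _) p) = DiffersAt u t i × Towards t p

towards-length : ∀ {k} (p : Walk n u v k) → Towards v p → hamming u v ≡ k
towards-length {u = u} (here _) _ = hamming-self u
towards-length {u = u} {v} (step {w = w} _ (i , flip) p) (uᵢ≢vᵢ , tp) =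
  trans (hamming-step u w v i flip uᵢ≢vᵢ) (cong suc (towards-length p tp))

towards⇒shortest : ∀ {k} (p : Walk n u v k) → Towards v p → IsShortest p
towards⇒shortest p tp k′ q = subst (_≤ k′) (towards-length p tp) (hamming≤length q)

towards-of-length≤hamming : ∀ {k} (p : Walk n u v k) → k ≤ hamming u v → Towards v p
towards-of-length≤hamming (here _) _ = tt
towards-of-length≤hamming {u = u} {v} (step {w = w} {k = k} _ (i , flip) p) k<h
  with lookup u i ≟ᵇ lookup v i
... | no uᵢ≢vᵢ =
  uᵢ≢vᵢ , towards-of-length≤hamming p (s≤s⁻¹ (subst (suc k ≤_) (hamming-step u w v i flip uᵢ≢vᵢ) k<h))
... | yes uᵢ≡vᵢ = ⊥-elim (<-irrefl refl (begin-strict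
  hamming u v       <⟨ n<1+n _ ⟩
  suc (hamming u v) ≡⟨ hamming-step w u v i (differOnlyAt-sym {u = u} {w = w} flip) wᵢ≢vᵢ ⟨
  hamming w v       ≤⟨ hamming≤length p ⟩
  k                 <⟨ k<h ⟩
  hamming u v       ∎))
  where
  open ≤-Reasoning
  wᵢ≢vᵢ : DiffersAt w v i
  wᵢ≢vᵢ wᵢ≡vᵢ = proj₁ flip (trans uᵢ≡vᵢ (sym wᵢ≡vᵢ))

record _⊑_ (x y : BStr n) : Set where
  constructor ⊑-intro
  field ⊑-lookup : ∀ i → lookup x i ≡ true → lookup y i ≡ true

lucas-⊑-closed : IsLucas n y → x ⊑ y → IsLucas n x
lucas-⊑-closed (cons , ends) (⊑-intro x⊑y) =
  (λ i j ij (xᵢ , xⱼ) → cons i j ij (x⊑y i xᵢ , x⊑y j xⱼ)) ,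
  (λ i j i₀ jₙ (xᵢ , xⱼ) → ends i j i₀ jₙ (x⊑y i xᵢ , x⊑y j xⱼ))

[]≔-⊑ : (u : BStr n) (i : Fin n) {e : Bool} → (∀ j → j ≢ i → lookup u j ≡ true → lookup y j ≡ true) →
        (e ≡ true → lookup y i ≡ true) → (u [ i ]≔ e) ⊑ y
[]≔-⊑ {y = y} u i {e} off at = ⊑-intro lookup-⊑
  where
  lookup-⊑ : ∀ j → lookup (u [ i ]≔ e) j ≡ true → lookup y j ≡ true
  lookup-⊑ j t with j ≟ᶠ i
  ... | yes refl = at (trans (sym (lookup∘update i u e)) t)
  ... | no j≢i   = off j j≢i (trans (sym (lookup∘update′ j≢i u e)) t)

[]≔false-⊑ : (u : BStr n) (i : Fin n) → (u [ i ]≔ false) ⊑ u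
[]≔false-⊑ u i = []≔-⊑ u i (λ _ _ → id) λ ()

⊑-trans : x ⊑ y → y ⊑ z → x ⊑ z
⊑-trans (⊑-intro x⊑y) (⊑-intro y⊑z) = ⊑-intro λ i → y⊑z i ∘ x⊑y i

lucas-closer-neighbour : IsLucas n u → IsLucas n v →
                         u ≡ v ⊎ Σ (Fin n) λ i → DiffersAt u v i × IsLucas n (u [ i ]≔ lookup v i)
lucas-closer-neighbour {u = u} {v} lu lv
  with any? (λ i → (lookup u i ≟ᵇ true) ×-dec (lookup v i ≟ᵇ false))
... | yes (i , uᵢ , vᵢ) =
  inj₂ (i , ≢-true-false uᵢ vᵢ , lucas-⊑-closed lu (subst (λ e → (u [ i ]≔ e) ⊑ u) (sym vᵢ) ([]≔false-⊑ u i)))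
... | no no-drop with any? (λ i → ¬? (lookup u i ≟ᵇ lookup v i))
...   | yes (i , uᵢ≢vᵢ) = inj₂ (i , uᵢ≢vᵢ , lucas-⊑-closed lv ([]≔-⊑ {y = v} u i (λ j _ → u⊑v j) id))
  where
  u⊑v : ∀ j → lookup u j ≡ true → lookup v j ≡ true
  u⊑v j uⱼ = ¬-not λ vⱼ → no-drop (j , uⱼ , vⱼ)
...   | no no-difference = inj₁ (lookup-extensionality u v λ i →
  decidable-stable (lookup u i ≟ᵇ lookup v i) λ uᵢ≢vᵢ → no-difference (i , uᵢ≢vᵢ))

geodesic-at-distance : ∀ h → hamming u v ≡ h → IsLucas n u → IsLucas n v →
                  Σ ℕ λ k → Σ (Walk n u v k) (Towards v)
geodesic-at-distance {u = u} {v} h eq lu lv with lucas-closer-neighbour {u = u} {v} lu lv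
... | inj₁ refl = 0 , here lu , tt
... | inj₂ (i , uᵢ≢vᵢ , lw) = descend h eq
  where
  flip : DifferOnlyAt u (u [ i ]≔ lookup v i) i
  flip = differOnlyAt-[]≔ u i uᵢ≢vᵢ
  closer : hamming u v ≡ suc (hamming (u [ i ]≔ lookup v i) v)
  closer = hamming-step u (u [ i ]≔ lookup v i) v i flip uᵢ≢vᵢ
  descend : ∀ h → hamming u v ≡ h → Σ ℕ λ k → Σ (Walk _ u v k) (Towards v)
  descend zero    eq = ⊥-elim (0≢1+n (trans (sym eq) closer))
  descend (suc h) eq
    with geodesic-at-distance {u = u [ i ]≔ lookup v i} {v} h (suc-injective (trans (sym closer) eq)) lw lv
  ... | k , p , tp = suc k , step lu (i , flip) p , uᵢ≢vᵢ , tp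

geodesic : IsLucas n u → IsLucas n v → Σ ℕ λ k → Σ (Walk n u v k) (Towards v)
geodesic {u = u} {v} = geodesic-at-distance {u = u} {v} _ refl

shortest⇒towards : ∀ {k} (p : Walk n u v k) → IsShortest p → Towards v p
shortest⇒towards {u = u} {v} p shortest with geodesic {u = u} {v} (walk-source-lucas p) (walk-target-lucas p)
... | k′ , q , tq =
  towards-of-length≤hamming p (≤-trans (shortest k′ q) (≤-reflexive (sym (towards-length q tq))))

-- Edge general position of two Θ-classes

towards-unflipped : ∀ {k} (p : Walk n u v k) → Towards t p → lookup u i ≡ lookup t i →
                    EdgeOn p a b → ¬ DiffersAt a b i
towards-unflipped {a = a} {b} (step {u = u} {w = w} _ (j , flip) p) (uⱼ≢tⱼ , tp) uᵢ≡tᵢ (inj₁ same) dab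
  with differOnlyAt-unique {u = u} {w = w} flip (sameEdge-differsAt {a = a} {b} same dab)
... | refl = uⱼ≢tⱼ uᵢ≡tᵢ
towards-unflipped {i = i} (step _ (j , flip) p) (uⱼ≢tⱼ , tp) uᵢ≡tᵢ (inj₂ on) dab with i ≟ᶠ j
... | yes refl = uⱼ≢tⱼ uᵢ≡tᵢ
... | no i≢j = towards-unflipped p tp (trans (sym (proj₂ flip i i≢j)) uᵢ≡tᵢ) on dab

towards-flips-once : ∀ {k} (p : Walk n u v k) → Towards t p → EdgeOn p a b → EdgeOn p c d →
                     DiffersAt a b i → DiffersAt c d i → SameEdge a b c d
towards-flips-once (step _ _ _) _ (inj₁ s) (inj₁ s′) _ _ = sameEdge-trans s (sameEdge-sym s′)
towards-flips-once {a = a} {b} (step {u = u} {w = w} _ (j , flip) p) (uⱼ≢tⱼ , tp) (inj₁ s) (inj₂ o) dab dcd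
  with differOnlyAt-unique {u = u} {w = w} flip (sameEdge-differsAt {a = a} {b} s dab)
... | refl = ⊥-elim (towards-unflipped p tp (≢-≢⇒≡ (proj₁ flip) uⱼ≢tⱼ) o dcd)
towards-flips-once {c = c} {d} (step {u = u} {w = w} _ (j , flip) p) (uⱼ≢tⱼ , tp) (inj₂ o) (inj₁ s) dab dcd
  with differOnlyAt-unique {u = u} {w = w} flip (sameEdge-differsAt {a = c} {d} s dcd)
... | refl = ⊥-elim (towards-unflipped p tp (≢-≢⇒≡ (proj₁ flip) uⱼ≢tⱼ) o dab)
towards-flips-once (step _ _ p) (_ , tp) (inj₂ o) (inj₂ o′) dab dcd = towards-flips-once p tp o o′ dab dcd

walk-crosses : ∀ {k} (p : Walk n u v k) → DiffersAt u v i →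
               Σ (BStr n) λ a → Σ (BStr n) λ b → EdgeOn p a b × IsEdge n a b × DiffersAt a b i
walk-crosses (here _) uᵢ≢vᵢ = ⊥-elim (uᵢ≢vᵢ refl)
walk-crosses {u = u} {i = i} (step {w = w} lu flip p) uᵢ≢vᵢ with lookup u i ≟ᵇ lookup w i
... | no uᵢ≢wᵢ = u , w , inj₁ (inj₁ (refl , refl)) , (lu , walk-source-lucas p , flip) , uᵢ≢wᵢ
... | yes uᵢ≡wᵢ with walk-crosses p (λ wᵢ≡vᵢ → uᵢ≢vᵢ (trans uᵢ≡wᵢ wᵢ≡vᵢ))
...   | a , b , on , e , dab = a , b , inj₂ on , e , dab

edgeGP-of-two-coordinates : (c₁ c₂ : Fin n) (X : EdgeSet n) →
  (∀ a b → X a b → IsEdge n a b × (DiffersAt a b c₁ ⊎ DiffersAt a b c₂)) → IsEdgeGP n X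
edgeGP-of-two-coordinates {n} c₁ c₂ X classify = (λ a b x → proj₁ (classify a b x)) , no-geodesic
  where
  Class : BStr n → BStr n → Set
  Class a b = DiffersAt a b c₁ ⊎ DiffersAt a b c₂
  no-geodesic : ∀ a₁ b₁ a₂ b₂ a₃ b₃ → X a₁ b₁ → X a₂ b₂ → X a₃ b₃ →
                ¬ SameEdge a₁ b₁ a₂ b₂ → ¬ SameEdge a₁ b₁ a₃ b₃ → ¬ SameEdge a₂ b₂ a₃ b₃ →
                ¬ OnCommonGeodesic n a₁ b₁ a₂ b₂ a₃ b₃
  no-geodesic a₁ b₁ a₂ b₂ a₃ b₃ x₁ x₂ x₃ ≉₁₂ ≉₁₃ ≉₂₃ (_ , _ , _ , p , shortest , on₁ , on₂ , on₃) =
    pigeonhole (proj₂ (classify a₁ b₁ x₁)) (proj₂ (classify a₂ b₂ x₂)) (proj₂ (classify a₃ b₃ x₃))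
    where
    once : EdgeOn p a b → EdgeOn p c d → DiffersAt a b i → DiffersAt c d i → SameEdge a b c d
    once = towards-flips-once p (shortest⇒towards p shortest)
    pigeonhole : Class a₁ b₁ → Class a₂ b₂ → Class a₃ b₃ → ⊥
    pigeonhole (inj₁ d₁) (inj₁ d₂) _        = ≉₁₂ (once on₁ on₂ d₁ d₂)
    pigeonhole (inj₂ d₁) (inj₂ d₂) _        = ≉₁₂ (once on₁ on₂ d₁ d₂)
    pigeonhole (inj₁ d₁) (inj₂ d₂) (inj₁ d₃) = ≉₁₃ (once on₁ on₃ d₁ d₃)
    pigeonhole (inj₁ d₁) (inj₂ d₂) (inj₂ d₃) = ≉₂₃ (once on₂ on₃ d₂ d₃)
    pigeonhole (inj₂ d₁) (inj₁ d₂) (inj₁ d₃) = ≉₂₃ (once on₂ on₃ d₂ d₃)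
    pigeonhole (inj₂ d₁) (inj₁ d₂) (inj₂ d₃) = ≉₁₃ (once on₁ on₃ d₁ d₃)

theta1n-classify : ∀ a b → Theta1n (suc k) a b →
                   IsEdge (suc k) a b × (DiffersAt a b zero ⊎ DiffersAt a b (fromℕ k))
theta1n-classify a b (e , i , inj₁ i₀ , dab) = e , inj₁ (subst (DiffersAt a b) (toℕ-injective i₀) dab)
theta1n-classify {k} a b (e , i , inj₂ iₙ , dab) =
  e , inj₂ (subst (DiffersAt a b) (toℕ-injective (trans iₙ (sym (toℕ-fromℕ k)))) dab)

theta1n-zero : (a b : BStr (suc k)) → IsEdge (suc k) a b → DiffersAt a b zero → Theta1n (suc k) a b
theta1n-zero a b e dab = e , zero , inj₁ refl , dab

theta1n-fromℕ : (a b : BStr (suc k)) → IsEdge (suc k) a b → DiffersAt a b (fromℕ k) → Theta1n (suc k) a b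
theta1n-fromℕ {k} a b e dab = e , fromℕ k , inj₂ (toℕ-fromℕ k) , dab

-- Shortest paths through a given edge

_++ʷ_ : ∀ {k l} → Walk n u w k → Walk n w v l → Walk n u v (k + l)
here _       ++ʷ q = q
step lu f p ++ʷ q = step lu f (p ++ʷ q)

edgeOn-++ʷʳ : ∀ {k l} (p : Walk n u w k) (q : Walk n w v l) → EdgeOn q a b → EdgeOn (p ++ʷ q) a b
edgeOn-++ʷʳ (here _)     q on = on
edgeOn-++ʷʳ (step _ _ p) q on = inj₂ (edgeOn-++ʷʳ p q on)

towards-++ʷ : ∀ {k l} (p : Walk n u w k) (q : Walk n w v l) → Towards t p → Towards t q → Towards t (p ++ʷ q)
towards-++ʷ (here _)     q _          tq = tq
towards-++ʷ (step _ _ p) q (uᵢ≢tᵢ , tp) tq = uᵢ≢tᵢ , towards-++ʷ p q tp tq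

Between : BStr n → BStr n → BStr n → Set
Between u x v = ∀ c → lookup u c ≡ lookup x c ⊎ lookup x c ≡ lookup v c

towards-retarget : ∀ {k} (p : Walk n u x k) → Towards x p → Between u x t → Towards t p
towards-retarget (here _) _ _ = tt
towards-retarget {u = u} {x = x} {t = t} (step {w = w} _ (i , flip) p) (uᵢ≢xᵢ , tp) between =
  uᵢ≢tᵢ (between i) , towards-retarget p tp between′
  where
  uᵢ≢tᵢ : lookup u i ≡ lookup x i ⊎ lookup x i ≡ lookup t i → DiffersAt u t i
  uᵢ≢tᵢ (inj₁ uᵢ≡xᵢ) = ⊥-elim (uᵢ≢xᵢ uᵢ≡xᵢ)
  uᵢ≢tᵢ (inj₂ xᵢ≡tᵢ) = λ uᵢ≡tᵢ → uᵢ≢xᵢ (trans uᵢ≡tᵢ (sym xᵢ≡tᵢ))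
  between′ : Between w x t
  between′ c with c ≟ᶠ i
  ... | yes refl = inj₁ (≢-≢⇒≡ (proj₁ flip) uᵢ≢xᵢ)
  ... | no c≢i   = subst (λ e → e ≡ lookup x c ⊎ lookup x c ≡ lookup t c) (proj₂ flip c c≢i) (between c)

shortest-walk-through-edge : IsLucas n u → IsLucas n v → IsLucas n x → IsLucas n y →
  Between u x v → DifferOnlyAt x y i → DiffersAt x v i →
  Σ ℕ λ k → Σ (Walk n u v k) λ p → IsShortest p × EdgeOn p x y
shortest-walk-through-edge {u = u} {v} {x} {y} {i} lu lv lx ly between flip xᵢ≢vᵢ
  with geodesic {u = u} {x} lu lx | geodesic {u = y} {v} ly lv
... | k , p , tp | l , q , tq =
  k + suc l , p ++ʷ xyq ,
  towards⇒shortest (p ++ʷ xyq) (towards-++ʷ p xyq (towards-retarget p tp between) (xᵢ≢vᵢ , tq)) ,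
  edgeOn-++ʷʳ p xyq (inj₁ (inj₁ (refl , refl)))
  where
  xyq : Walk _ x v (suc l)
  xyq = step lx (i , flip) q

GeodesicAcross : (n : ℕ) → BStr n → BStr n → Fin n → Fin n → Set
GeodesicAcross n x y i j = Σ (BStr n) λ a → Σ (BStr n) λ b → Σ (BStr n) λ c → Σ (BStr n) λ d →
  (IsEdge n a b × DiffersAt a b i) × (IsEdge n c d × DiffersAt c d j) × OnCommonGeodesic n x y a b c d

geodesicAcross-swap : GeodesicAcross n x y i j → GeodesicAcross n x y j i
geodesicAcross-swap (a , b , c , d , ab , cd , (s , t , k , p , sh , on , on₁ , on₂)) =
  c , d , a , b , cd , ab , (s , t , k , p , sh , on , on₂ , on₁)

geodesic-across : IsLucas n u → IsLucas n v → IsLucas n x → IsLucas n y →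
  Between u x v → DifferOnlyAt x y i → DiffersAt x v i → DiffersAt u v j → DiffersAt u v j′ →
  GeodesicAcross n x y j j′
geodesic-across {u = u} {v} {x} {y} lu lv lx ly between flip xᵢ≢vᵢ uⱼ≢vⱼ uⱼ′≢vⱼ′
  with shortest-walk-through-edge {u = u} {v} {x} {y} lu lv lx ly between flip xᵢ≢vᵢ
... | k , p , shortest , on with walk-crosses p uⱼ≢vⱼ | walk-crosses p uⱼ′≢vⱼ′
...   | a , b , on₁ , eab , dab | c , d , on₂ , ecd , dcd =
  a , b , c , d , (eab , dab) , (ecd , dcd) , (u , v , k , p , shortest , on , on₁ , on₂)

Consecutive : Fin n → Fin n → Set
Consecutive i j = toℕ j ≡ suc (toℕ i)

Ends : Fin n → Fin n → Set
Ends {n} i j = toℕ i ≡ 0 × toℕ j ≡ n ∸ 1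

CyclicallyAdjacent : Fin n → Fin n → Set
CyclicallyAdjacent i j = Consecutive i j ⊎ Consecutive j i ⊎ Ends i j ⊎ Ends j i

NoOnesOn : (Fin n → Fin n → Set) → BStr n → Set
NoOnesOn R x = ∀ i j → R i j → ¬ (lookup x i ≡ true × lookup x j ≡ true)

raise-noOnesOn : (R : Fin n → Fin n → Set) (z : BStr n) (j : Fin n) → (∀ {i j} → R i j → i ≢ j) →
  (∀ i → R j i → lookup z i ≡ false) → (∀ i → R i j → lookup z i ≡ false) →
  NoOnesOn R z → NoOnesOn R (z [ j ]≔ true)
raise-noOnesOn R z j irreflexive right left ones i i′ r (zᵢ , zᵢ′)
  with i ≟ᶠ j | i′ ≟ᶠ j
... | yes refl | yes refl = irreflexive r refl
... | yes refl | no i′≢j  = ≢-true-false (trans (sym (lookup∘update′ i′≢j z true)) zᵢ′) (right i′ r) refl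
... | no i≢j   | yes refl = ≢-true-false (trans (sym (lookup∘update′ i≢j z true)) zᵢ) (left i r) refl
... | no i≢j   | no i′≢j  =
  ones i i′ r (trans (sym (lookup∘update′ i≢j z true)) zᵢ , trans (sym (lookup∘update′ i′≢j z true)) zᵢ′)

lucas-raise : (z : BStr (2 + k)) (j : Fin (2 + k)) → IsLucas (2 + k) z →
  (∀ i → CyclicallyAdjacent j i → lookup z i ≡ false) → IsLucas (2 + k) (z [ j ]≔ true)
lucas-raise z j (consecutive , ends) free =
  raise-noOnesOn Consecutive z j consecutive-irreflexive
    (λ i r → free i (inj₁ r)) (λ i r → free i (inj₂ (inj₁ r))) consecutive ,
  λ i i′ i₀ i′ₙ → raise-noOnesOn Ends z j ends-irreflexive
    (λ i r → free i (inj₂ (inj₂ (inj₁ r)))) (λ i r → free i (inj₂ (inj₂ (inj₂ r))))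
    (λ i i′ (i₀ , i′ₙ) → ends i i′ i₀ i′ₙ) i i′ (i₀ , i′ₙ)
  where
  consecutive-irreflexive : ∀ {i i′ : Fin (2 + k)} → Consecutive i i′ → i ≢ i′
  consecutive-irreflexive r refl = 1+n≢n (sym r)
  ends-irreflexive : ∀ {i i′ : Fin (2 + k)} → Ends i i′ → i ≢ i′
  ends-irreflexive (i₀ , i′ₙ) refl = 0≢1+n (trans (sym i₀) i′ₙ)

clear : Fin n → Fin n → BStr n → BStr n
clear p q z = (z [ p ]≔ false) [ q ]≔ false

lookup-clear : (z : BStr n) (p q : Fin n) → i ≡ p ⊎ i ≡ q → lookup (clear p q z) i ≡ false
lookup-clear z p q (inj₂ refl) = lookup∘update q (z [ p ]≔ false) false
lookup-clear {i = i} z p q (inj₁ refl) with i ≟ᶠ q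
... | yes refl = lookup∘update i (z [ i ]≔ false) false
... | no i≢q   = trans (lookup∘update′ i≢q (z [ i ]≔ false) false) (lookup∘update i z false)

pin : Fin n → Fin n → Fin n → BStr n → BStr n
pin j p q z = clear p q z [ j ]≔ true

lucas-pin : (z : BStr (2 + k)) (j p q : Fin (2 + k)) → IsLucas (2 + k) z →
  (∀ i → CyclicallyAdjacent j i → i ≡ p ⊎ i ≡ q) → IsLucas (2 + k) (pin j p q z)
lucas-pin z j p q lz neighbours =
  lucas-raise (clear p q z) j (lucas-⊑-closed lz (⊑-trans ([]≔false-⊑ (z [ p ]≔ false) q) ([]≔false-⊑ z p)))
    λ i adj → lookup-clear z p q (neighbours i adj)

lookup-pin-pole : (z : BStr n) (j p q : Fin n) → lookup (pin j p q z) j ≡ true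
lookup-pin-pole z j p q = lookup∘update j (clear p q z) true

lookup-pin-cleared : (z : BStr n) (j p q : Fin n) → i ≢ j → i ≡ p ⊎ i ≡ q → lookup (pin j p q z) i ≡ false
lookup-pin-cleared z j p q i≢j i∈pq = trans (lookup∘update′ i≢j (clear p q z) true) (lookup-clear z p q i∈pq)

lookup-pin-other : (z : BStr n) (j p q : Fin n) → i ≢ j → i ≢ p → i ≢ q → lookup (pin j p q z) i ≡ lookup z i
lookup-pin-other z j p q i≢j i≢p i≢q =
  trans (lookup∘update′ i≢j (clear p q z) true)
        (trans (lookup∘update′ i≢q (z [ p ]≔ false) false) (lookup∘update′ i≢p z false))

between-pins : (x y : BStr n) (j p j′ p′ : Fin n) → j ≢ j′ → p ≢ j → p ≢ j′ → p ≢ p′ →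
  DifferOnlyAt x y i → lookup x i ≡ false → Between (pin j p j′ x) x (pin j′ p′ j y)
between-pins {i = i} x y j p j′ p′ j≢j′ p≢j p≢j′ p≢p′ flip xᵢ c with c ≟ᶠ j | c ≟ᶠ j′ | c ≟ᶠ p
... | yes refl | _        | _        =
  ≢⇒between _ (≢-true-false (lookup-pin-pole x j p j′) (lookup-pin-cleared y j′ p′ j j≢j′ (inj₂ refl)))
... | no c≢j   | yes refl | _        =
  ≢⇒between _ (≢-true-false (lookup-pin-pole y j′ p′ j) (lookup-pin-cleared x j p j′ c≢j (inj₂ refl)) ∘ sym)
... | no c≢j   | no c≢j′  | no c≢p   = inj₁ (lookup-pin-other x j p j′ c≢j c≢p c≢j′)
... | no c≢j   | no c≢j′  | yes refl with c ≟ᶠ i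
...   | yes refl = inj₁ (trans (lookup-pin-cleared x j p j′ p≢j (inj₁ refl)) (sym xᵢ))
...   | no p≢i   = inj₂ (trans (proj₂ flip p p≢i) (sym (lookup-pin-other y j′ p′ j p≢j′ p≢p′ p≢j)))

geodesic-across-pins : (x y : BStr (2 + k)) (j p j′ p′ : Fin (2 + k)) →
  (∀ i → CyclicallyAdjacent j i → i ≡ p ⊎ i ≡ j′) → (∀ i → CyclicallyAdjacent j′ i → i ≡ p′ ⊎ i ≡ j) →
  j ≢ j′ → p ≢ j → p ≢ j′ → p ≢ p′ → IsLucas (2 + k) x → IsLucas (2 + k) y →
  DifferOnlyAt x y i → lookup x i ≡ false → i ≢ j → i ≢ j′ → i ≢ p′ → GeodesicAcross (2 + k) x y j j′
geodesic-across-pins x y j p j′ p′ around-j around-j′ j≢j′ p≢j p≢j′ p≢p′ lx ly flip xᵢ i≢j i≢j′ i≢p′ =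
  geodesic-across {u = pin j p j′ x} {pin j′ p′ j y} {x} {y}
    (lucas-pin x j p j′ lx around-j) (lucas-pin y j′ p′ j ly around-j′) lx ly
    (between-pins x y j p j′ p′ j≢j′ p≢j p≢j′ p≢p′ flip xᵢ) flip
    (λ xᵢ≡vᵢ → proj₁ flip (trans xᵢ≡vᵢ (lookup-pin-other y j′ p′ j i≢j′ i≢p′ i≢j)))
    (≢-true-false (lookup-pin-pole x j p j′) (lookup-pin-cleared y j′ p′ j j≢j′ (inj₂ refl)))
    (≢-true-false (lookup-pin-pole y j′ p′ j) (lookup-pin-cleared x j p j′ (j≢j′ ∘ sym) (inj₂ refl)) ∘ sym)

raisedEdge : Fin n → BStr n → BStr n × BStr n
raisedEdge j x = x , x [ j ]≔ true

raisedEdge-injective : (x y : BStr n) (j : Fin n) → SameEdge x (x [ j ]≔ true) y (y [ j ]≔ true) → x ≡ y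
raisedEdge-injective x y j (inj₁ (x≡y , _))       = x≡y
raisedEdge-injective x y j (inj₂ (x≡y′ , x′≡y)) = begin
  x                   ≡⟨ []≔-lookup x j ⟨
  x [ j ]≔ lookup x j ≡⟨ cong (x [ j ]≔_) xⱼ ⟩
  x [ j ]≔ true       ≡⟨ x′≡y ⟩
  y                   ∎
  where
  open ≡-Reasoning
  xⱼ : lookup x j ≡ true
  xⱼ = trans (cong (λ z → lookup z j) x≡y′) (lookup∘update j y true)

raisedEdge-isEdge : (x : BStr (2 + k)) (j : Fin (2 + k)) → IsLucas (2 + k) x → lookup x j ≡ false →
  (∀ i → CyclicallyAdjacent j i → lookup x i ≡ false) →
  IsEdge (2 + k) x (x [ j ]≔ true) × DiffersAt x (x [ j ]≔ true) j
raisedEdge-isEdge x j lx xⱼ free = (lx , lucas-raise x j lx free , j , flip) , proj₁ flip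
  where
  flip : DifferOnlyAt x (x [ j ]≔ true) j
  flip = differOnlyAt-[]≔ x j λ xⱼ≡true → ≢-true-false xⱼ≡true xⱼ refl

-- Fibonacci strings

NoAdjacentOnes : Vec Bool k → Set
NoAdjacentOnes []                = ⊤
NoAdjacentOnes (true ∷ true ∷ _) = ⊥
NoAdjacentOnes (_ ∷ v)           = NoAdjacentOnes v

noAdjacentOnes-tail : ∀ e (v : Vec Bool k) → NoAdjacentOnes (e ∷ v) → NoAdjacentOnes v
noAdjacentOnes-tail false v         na = na
noAdjacentOnes-tail true  []        _  = tt
noAdjacentOnes-tail true  (false ∷ v) na = na

noAdjacentOnes-∷ʳ-false : (v : Vec Bool k) → NoAdjacentOnes v → NoAdjacentOnes (v ∷ʳ false)
noAdjacentOnes-∷ʳ-false []               _  = tt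
noAdjacentOnes-∷ʳ-false (false ∷ v)      na = noAdjacentOnes-∷ʳ-false v na
noAdjacentOnes-∷ʳ-false (true ∷ [])      _  = tt
noAdjacentOnes-∷ʳ-false (true ∷ false ∷ v) na = noAdjacentOnes-∷ʳ-false (false ∷ v) na

noAdjacentOnes-consecutive : (v : Vec Bool k) → NoAdjacentOnes v → NoOnesOn Consecutive v
noAdjacentOnes-consecutive (e ∷ v) na (suc i) (suc j) ij =
  noAdjacentOnes-consecutive v (noAdjacentOnes-tail e v na) i j (suc-injective ij)
noAdjacentOnes-consecutive (false ∷ _ ∷ _)    _  zero (suc zero) _ (() , _)
noAdjacentOnes-consecutive (true ∷ false ∷ _) _  zero (suc zero) _ (_ , ())
noAdjacentOnes-consecutive (true ∷ true ∷ _)  () zero (suc zero) _ _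

lucas-false∷ : (v : Vec Bool k) → NoAdjacentOnes v → IsLucas (suc k) (false ∷ v)
lucas-false∷ v na =
  noAdjacentOnes-consecutive (false ∷ v) na ,
  λ { zero _ _ _ (() , _) ; (suc _) _ () _ _ }

fibStrings : (k : ℕ) → List (Vec Bool k)
fibStrings zero                = [] ∷ []
fibStrings (suc zero)          = (false ∷ []) ∷ (true ∷ []) ∷ []
fibStrings (suc (suc k)) =
  map (false ∷_) (fibStrings (suc k)) ++ map (λ v → true ∷ false ∷ v) (fibStrings k)

fibStrings-noAdjacentOnes : (k : ℕ) → All NoAdjacentOnes (fibStrings k)
fibStrings-noAdjacentOnes zero          = tt All.∷ All.[]
fibStrings-noAdjacentOnes (suc zero)    = tt All.∷ tt All.∷ All.[]
fibStrings-noAdjacentOnes (suc (suc k)) =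
  All.++⁺ (All.map⁺ (fibStrings-noAdjacentOnes (suc k))) (All.map⁺ (fibStrings-noAdjacentOnes k))

fibStrings-unique : (k : ℕ) → Unique (fibStrings k)
fibStrings-unique zero          = All.[] AllPairs.∷ AllPairs.[]
fibStrings-unique (suc zero)    = ((λ ()) All.∷ All.[]) AllPairs.∷ All.[] AllPairs.∷ AllPairs.[]
fibStrings-unique (suc (suc k)) =
  Unique.++⁺ (Unique.map⁺ ∷-injectiveʳ (fibStrings-unique (suc k)))
             (Unique.map⁺ (∷-injectiveʳ ∘ ∷-injectiveʳ) (fibStrings-unique k))
             disjoint
  where
  disjoint : ∀ {v} →
    ¬ (v ∈ map (false ∷_) (fibStrings (suc k)) × v ∈ map (λ v → true ∷ false ∷ v) (fibStrings k))
  disjoint (v∈₁ , v∈₂) with ∈-map⁻ (false ∷_) v∈₁ | ∈-map⁻ (λ v → true ∷ false ∷ v) v∈₂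
  ... | _ , _ , refl | _ , _ , ()

length-fibStrings : (k : ℕ) → length (fibStrings k) ≡ fib (2 + k)
length-fibStrings zero          = refl
length-fibStrings (suc zero)    = refl
length-fibStrings (suc (suc k)) =
  trans (length-++ (map (false ∷_) (fibStrings (suc k))))
        (cong₂ _+_ (trans (length-map _ (fibStrings (suc k))) (length-fibStrings (suc k)))
                   (trans (length-map _ (fibStrings k)) (length-fibStrings k)))

-- Θ₁ ∪ Θₙ in Λₙ for n = m + 4

module Λ (m : ℕ) where

  N : ℕ
  N = 4 + m

  first second penult last : Fin N
  first  = zero
  second = suc zero
  penult = inject₁ (fromℕ (2 + m))
  last   = fromℕ (3 + m)

  first≢last : first ≢ last
  first≢last ()

  penult≢last : penult ≢ last
  penult≢last e = fromℕ≢inject₁ (sym (suc-injectiveᶠ (suc-injectiveᶠ e)))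

  around-first : ∀ i → CyclicallyAdjacent first i → i ≡ second ⊎ i ≡ last
  around-first i (inj₁ i₁)                    = inj₁ (toℕ-injective i₁)
  around-first i (inj₂ (inj₁ ()))
  around-first i (inj₂ (inj₂ (inj₁ (_ , iₙ)))) = inj₂ (toℕ-injective (trans iₙ (sym (toℕ-fromℕ (3 + m)))))
  around-first i (inj₂ (inj₂ (inj₂ (_ , ()))))

  around-last : ∀ i → CyclicallyAdjacent last i → i ≡ penult ⊎ i ≡ first
  around-last i (inj₁ iₙ₊₁) = ⊥-elim (<-irrefl (trans iₙ₊₁ (cong suc (toℕ-fromℕ (3 + m)))) (toℕ<n i))
  around-last i (inj₂ (inj₁ iₙ₋₁)) =
    inj₁ (toℕ-injective (trans (suc-injective (trans (sym iₙ₋₁) (toℕ-fromℕ (3 + m))))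
                               (sym (trans (toℕ-inject₁ (fromℕ (2 + m))) (toℕ-fromℕ (2 + m))))))
  around-last i (inj₂ (inj₂ (inj₁ (() , _))))
  around-last i (inj₂ (inj₂ (inj₂ (i₀ , _)))) = inj₂ (toℕ-injective i₀)

  geodesic-across-ends : (x y : BStr N) → IsLucas N x → IsLucas N y → DifferOnlyAt x y i →
    lookup x i ≡ false → i ≢ first → i ≢ last → GeodesicAcross N x y first last
  -- Pinning coordinate n clears coordinate n - 1, which would undo the edge when
  -- i = n - 1; in that case the geodesic runs from the Θₙ side to the Θ₁ side.
  geodesic-across-ends {i} x y lx ly flip xᵢ i≢first i≢last with i ≟ᶠ penult
  ... | no i≢penult =
    geodesic-across-pins x y first second last penult around-first around-last
      first≢last (λ ()) (λ ()) (λ ()) lx ly flip xᵢ i≢first i≢last i≢penult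
  ... | yes refl = geodesicAcross-swap {x = x} {y}
    (geodesic-across-pins x y last penult first second around-last around-first
      (first≢last ∘ sym) penult≢last (λ ()) (λ ()) lx ly flip xᵢ i≢last i≢first (λ ()))

  theta1n-maximal : ∀ u v → IsEdge N u v → ¬ Theta1n N u v → ¬ IsEdgeGP N (addEdge (Theta1n N) u v)
  theta1n-maximal u v e@(lu , lv , i , flip) ¬θ (_ , no-geodesic) = orient (lookup u i ≟ᵇ false)
    where
    i≢first : i ≢ first
    i≢first i≡first = ¬θ (theta1n-zero u v e (subst (DiffersAt u v) i≡first (proj₁ flip)))
    i≢last : i ≢ last
    i≢last i≡last = ¬θ (theta1n-fromℕ u v e (subst (DiffersAt u v) i≡last (proj₁ flip)))
    refute : ∀ x y → SameEdge x y u v → GeodesicAcross N x y first last → ⊥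
    refute x y xy≈uv (a , b , c , d , (eab , dab) , (ecd , dcd) , geodesic) =
      no-geodesic x y a b c d (inj₂ xy≈uv) (inj₁ (theta1n-zero a b eab dab)) (inj₁ (theta1n-fromℕ c d ecd dcd))
        (λ s → i≢first (isEdge-differsAt-unique {a = u} {v} e (proj₁ flip) (sameEdge-differsAt (uv≈ s) dab)))
        (λ s → i≢last (isEdge-differsAt-unique {a = u} {v} e (proj₁ flip) (sameEdge-differsAt (uv≈ s) dcd)))
        (λ s → first≢last (isEdge-differsAt-unique {a = c} {d} ecd (sameEdge-differsAt {a = a} {b} s dab) dcd))
        geodesic
      where
      uv≈ : ∀ {a b} → SameEdge x y a b → SameEdge a b u v
      uv≈ s = sameEdge-trans (sameEdge-sym s) xy≈uv
    orient : Dec (lookup u i ≡ false) → ⊥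
    orient (yes uᵢ) = refute u v (inj₁ (refl , refl)) (geodesic-across-ends u v lu lv flip uᵢ i≢first i≢last)
    orient (no uᵢ≢false) = refute v u (inj₂ (refl , refl))
      (geodesic-across-ends v u lv lu (differOnlyAt-sym {u = u} {w = v} flip) (≢-≢⇒≡ (proj₁ flip) uᵢ≢false)
        i≢first i≢last)

  lowFirst : Vec Bool (suc m) → BStr N
  lowFirst w = false ∷ false ∷ (w ∷ʳ false)

  lowLast : Vec Bool (suc m) → BStr N
  lowLast w = false ∷ ((w ∷ʳ false) ∷ʳ false)

  lowFirst-injective : (w w′ : Vec Bool (suc m)) → lowFirst w ≡ lowFirst w′ → w ≡ w′
  lowFirst-injective w w′ e = ∷ʳ-injectiveˡ w w′ (∷-injectiveʳ (∷-injectiveʳ e))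

  lowLast-injective : (w w′ : Vec Bool (suc m)) → lowLast w ≡ lowLast w′ → w ≡ w′
  lowLast-injective w w′ e = ∷ʳ-injectiveˡ w w′ (∷ʳ-injectiveˡ (w ∷ʳ false) (w′ ∷ʳ false) (∷-injectiveʳ e))

  Classified : BStr N × BStr N → Set
  Classified (a , b) = IsEdge N a b × (DiffersAt a b first ⊎ DiffersAt a b last)

  lowFirst-classified : (w : Vec Bool (suc m)) → NoAdjacentOnes w → Classified (raisedEdge first (lowFirst w))
  lowFirst-classified w na =
    map₂ inj₁ (raisedEdge-isEdge (lowFirst w) first (lucas-false∷ _ (noAdjacentOnes-∷ʳ-false w na)) refl free)
    where
    free : ∀ i → CyclicallyAdjacent first i → lookup (lowFirst w) i ≡ false
    free i adj with around-first i adj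
    ... | inj₁ refl = refl
    ... | inj₂ refl = lookup-∷ʳ-last w

  lowLast-classified : (w : Vec Bool (suc m)) → NoAdjacentOnes w → Classified (raisedEdge last (lowLast w))
  lowLast-classified w na =
    map₂ inj₂ (raisedEdge-isEdge (lowLast w) last
      (lucas-false∷ _ (noAdjacentOnes-∷ʳ-false (w ∷ʳ false) (noAdjacentOnes-∷ʳ-false w na)))
      (lookup-∷ʳ-last (w ∷ʳ false)) free)
    where
    free : ∀ i → CyclicallyAdjacent last i → lookup (lowLast w) i ≡ false
    free i adj with around-last i adj
    ... | inj₁ refl = trans (lookup-∷ʳ-inject₁ (w ∷ʳ false) (fromℕ (suc m))) (lookup-∷ʳ-last w)
    ... | inj₂ refl = refl

  middles : List (Vec Bool (suc m))
  middles = fibStrings (suc m)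

  theta1n-edges : List (BStr N × BStr N)
  theta1n-edges = map (raisedEdge first ∘ lowFirst) middles ++ map (raisedEdge last ∘ lowLast) middles

  theta1n-edges-classified : All Classified theta1n-edges
  theta1n-edges-classified = All.++⁺
    (All.map⁺ (All.map (λ {w} → lowFirst-classified w) (fibStrings-noAdjacentOnes (suc m))))
    (All.map⁺ (All.map (λ {w} → lowLast-classified w) (fibStrings-noAdjacentOnes (suc m))))

  DistinctEdges : BStr N × BStr N → BStr N × BStr N → Set
  DistinctEdges e f = ¬ SameEdge (proj₁ e) (proj₂ e) (proj₁ f) (proj₂ f)

  theta1n-edges-distinct : AllPairs DistinctEdges theta1n-edges
  theta1n-edges-distinct = AllPairs.++⁺
    (AllPairs.map⁺ (AllPairs.map (λ {w} {w′} w≢w′ s →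
      w≢w′ (lowFirst-injective w w′ (raisedEdge-injective (lowFirst w) (lowFirst w′) first s)))
      (fibStrings-unique (suc m))))
    (AllPairs.map⁺ (AllPairs.map (λ {w} {w′} w≢w′ s →
      w≢w′ (lowLast-injective w w′ (raisedEdge-injective (lowLast w) (lowLast w′) last s)))
      (fibStrings-unique (suc m))))
    (All.map⁺ (All.tabulate λ _ → All.map⁺ (All.tabulate λ _ → λ { (inj₁ (_ , ())) ; (inj₂ (_ , ())) })))

  length-theta1n-edges : length theta1n-edges ≡ 2 * fib (N ∸ 1)
  length-theta1n-edges = begin
    length (map f middles ++ map g middles)         ≡⟨ length-++ (map f middles) ⟩
    length (map f middles) + length (map g middles) ≡⟨ cong₂ _+_ (length-map f middles) (length-map g middles) ⟩
    length middles + length middles                 ≡⟨ cong (λ l → l + l) (length-fibStrings (suc m)) ⟩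
    fib (3 + m) + fib (3 + m)                       ≡⟨ cong (fib (3 + m) +_) (+-identityʳ (fib (3 + m))) ⟨
    2 * fib (N ∸ 1)                                 ∎
    where
    open ≡-Reasoning
    f g : Vec Bool (suc m) → BStr N × BStr N
    f = raisedEdge first ∘ lowFirst
    g = raisedEdge last ∘ lowLast

  theta1n-gpe : GpeAtLeast N (2 * fib (N ∸ 1))
  theta1n-gpe =
    theta1n-edges , theta1n-edges-distinct ,
    edgeGP-of-two-coordinates first last (listSet theta1n-edges) classify ,
    ≤-reflexive (sym length-theta1n-edges)
    where
    classify : ∀ a b → listSet theta1n-edges a b → Classified (a , b)
    classify a b (inj₁ ab∈) = All.lookup theta1n-edges-classified ab∈
    classify a b (inj₂ ba∈) with All.lookup theta1n-edges-classified ba∈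
    ... | e , dba = isEdge-sym {a = b} {a} e , Sum.map (_∘ sym) (_∘ sym) dba

theorem4p6 : (n : ℕ) → 4 ≤ n →
    IsMaximalEdgeGP n (Theta1n n) × GpeAtLeast n (2 * fib (n ∸ 1))
theorem4p6 (suc (suc (suc (suc m)))) _ =
  (edgeGP-of-two-coordinates first last (Theta1n N) theta1n-classify , theta1n-maximal) , theta1n-gpe
  where open Λ m
theorem4p6 1 (s≤s ())
theorem4p6 2 (s≤s (s≤s ()))
theorem4p6 3 (s≤s (s≤s (s≤s ())))
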